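{- Let $G$ be a finite connected loopless multigraph and let $v_0 \in V(G)$. Let $e_1,\ldots,e_k \in E(G)$ be the edges incident with $v_0$, and for each $i$ let $v_i \in V(G)\setminus\{v_0\}$ be the other endpoint of $e_i$. Let $H$ be a subdivision of $G$, let $D$ be a divisor on $H$ of rank at least $1$ which is $v_0$-reduced, and let $w \in V(H)$ be a vertex with $D(w) = 0$. Then an execution of Dhar's burning algorithm on $(H,D,w)$ has the following properties: (a) $v_0$ is not burned; (b) if $I \subseteq \{i \in \{1,\dots,k\} : v_i \text{ is burned}\}$, then $\sum_{x \in \bigcup_{i\in I} [v_0,v_i)^{e_i}} D(x) \geq |I|$.
   Context: A subdivision $H$ of $G$ replaces each edge $e=uw$ of $G$ by a path $[u,w]^e = u x_1\cdots x_m w$ ($m\ge 0$) with new internal vertices; $[v_0,v_i)^{e_i}$ denotes the vertex set of the path corresponding to $e_i$ with $v_i$ removed (it contains $v_0$). Divisors on $H$ are formal $\mathbb{Z}$-combinations of vertices, $D(x)$ denotes the coefficient of $x$. Principal divisors are $L_H y$, $y\in\mathbb{Z}^{V(H)}$, with $L_H$ the Laplacian; equivalence means differing by a principal divisor; the rank of $D$ is the largest $k$ such that $D-E$ is equivalent to an effective divisor for every effective $E$ of degree $k$. Given a divisor $D$, a set $A\subseteq V(H)$ is valid if $D(v)\ge |\{\text{edges } uv : u\notin A\}|$ for all $v\in A$. $D$ is $q$-reduced if $D(v)\ge 0$ for all $v\ne q$ and every nonempty valid set contains $q$. Dhar's burning algorithm on $(H,D,q)$: burn the vertex $q$; then repeatedly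 burn all edges incident to burned vertices, and burn every vertex $v$ incident to more burned edges than $D(v)$; stop when nothing new is burned. (The set of unburned vertices is the maximal valid subset of $V(H)\setminus\{q\}$.) -}

module Defs where

open import Data.Nat using (ℕ; zero; suc)
open import Data.Bool using (Bool; true; false; _∧_; _∨_; not; if_then_else_)
open import Data.Fin using (Fin; zero; suc; inject₁)
open import Data.Fin.Properties using (_≟_)
open import Data.Integer using (ℤ; +_; 0ℤ; _-_; _≤_; _<?_)
import Data.Integer as ℤ
open import Data.Vec using (Vec; lookup; _∷_; _∷ʳ_)
open import Data.Product using (Σ; ∃; _×_; _,_; proj₁; proj₂)
open import Data.Sum using (_⊎_)
open import Function using (_∘_)
open import Function.Bundles using (_↔_; Inverse)
open import Relation.Nullary using (¬_)
open import Relation.Nullary.Decidable using (⌊_⌋)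
open import Relation.Binary.PropositionalEquality using (_≡_; _≢_)

sumℤ : ∀ {n} → (Fin n → ℤ) → ℤ
sumℤ {zero}  f = 0ℤ
sumℤ {suc n} f = f zero ℤ.+ sumℤ (f ∘ suc)

countF : ∀ {n} → (Fin n → Bool) → ℕ
countF {zero}  P = 0
countF {suc n} P = (if P zero then 1 else 0) Data.Nat.+ countF (P ∘ suc)

anyF : ∀ {n} → (Fin n → Bool) → Bool
anyF {zero}  P = false
anyF {suc n} P = P zero ∨ anyF (P ∘ suc)

-- Finite multigraphs: vertices Fin nV, edges Fin nE, each edge e
-- has endpoints src e and tgt e (orientation is irrelevant).

record Multigraph : Set where
  field
    nV  : ℕ
    nE  : ℕ
    src : Fin nE → Fin nV
    tgt : Fin nE → Fin nV
open Multigraph public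

Loopless : Multigraph → Set
Loopless G = ∀ e → src G e ≢ tgt G e

Adjacent : (G : Multigraph) → Fin (nV G) → Fin (nV G) → Set
Adjacent G u v = ∃ λ e → (src G e ≡ u × tgt G e ≡ v) ⊎ (src G e ≡ v × tgt G e ≡ u)

data Reach (G : Multigraph) : Fin (nV G) → Fin (nV G) → Set where
  here : ∀ {u} → Reach G u u
  step : ∀ {u v w} → Adjacent G u v → Reach G v w → Reach G u w

Connected : Multigraph → Set
Connected G = ∀ u v → Reach G u v

-- H is a subdivision of G.
-- ι embeds V(G) into V(H); edge e of G becomes the path
--   ι (src e) , inner e [0] , … , inner e [len e - 1] , ι (tgt e)
-- with len e ≥ 0 new internal vertices.

InnerPos : (G : Multigraph) → (Fin (nE G) → ℕ) → Set
InnerPos G len = Σ (Fin (nE G)) (λ e → Fin (len e))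

record Subdivision (G H : Multigraph) : Set where
  field
    ι      : Fin (nV G) → Fin (nV H)
    ι-inj  : ∀ a b → ι a ≡ ι b → a ≡ b
    len    : Fin (nE G) → ℕ
    inner  : (e : Fin (nE G)) → Vec (Fin (nV H)) (len e)
  pos : InnerPos G len → Fin (nV H)
  pos (e , j) = lookup (inner e) j
  walk : (e : Fin (nE G)) → Vec (Fin (nV H)) (suc (suc (len e)))
  walk e = ι (src G e) ∷ (inner e ∷ʳ ι (tgt G e))
  field
    pos-inj  : ∀ p q → pos p ≡ pos q → p ≡ q
    pos-new  : ∀ a p → ι a ≢ pos p
    covers   : ∀ x → (∃ λ a → ι a ≡ x) ⊎ (∃ λ p → pos p ≡ x)
    edgeMap  : Fin (nE H) ↔ Σ (Fin (nE G)) (λ e → Fin (suc (len e)))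
    edgeEnds : ∀ f →
      let e = proj₁ (Inverse.to edgeMap f)
          j = proj₂ (Inverse.to edgeMap f)
          a = lookup (walk e) (inject₁ j)
          b = lookup (walk e) (suc j)
      in (src H f ≡ a × tgt H f ≡ b) ⊎ (src H f ≡ b × tgt H f ≡ a)
open Subdivision public

Div : Multigraph → Set
Div H = Fin (nV H) → ℤ

deg : (H : Multigraph) → Div H → ℤ
deg H D = sumℤ D

Effective : (H : Multigraph) → Div H → Set
Effective H D = ∀ v → 0ℤ ≤ D v

laplacian : (H : Multigraph) → (Fin (nV H) → ℤ) → Div H
laplacian H y v = sumℤ (λ f →
  (if ⌊ src H f ≟ v ⌋ then y (src H f) - y (tgt H f) else 0ℤ) ℤ.+
  (if ⌊ tgt H f ≟ v ⌋ then y (tgt H f) - y (src H f) else 0ℤ))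

Equiv : (H : Multigraph) → Div H → Div H → Set
Equiv H D D' = ∃ λ y → ∀ v → D v - D' v ≡ laplacian H y v

RankAtLeast : (H : Multigraph) → Div H → ℕ → Set
RankAtLeast H D k = ∀ (E : Div H) → Effective H E → deg H E ≡ + k →
  ∃ λ (D' : Div H) → Effective H D' × Equiv H (λ v → D v - E v) D'

edgesTo : (H : Multigraph) → (Fin (nV H) → Bool) → Fin (nV H) → ℕ
edgesTo H P v = countF (λ f →
  (⌊ src H f ≟ v ⌋ ∧ P (tgt H f)) ∨ (⌊ tgt H f ≟ v ⌋ ∧ P (src H f)))

Valid : (H : Multigraph) → Div H → (Fin (nV H) → Bool) → Set
Valid H D A = ∀ v → A v ≡ true → + edgesTo H (not ∘ A) v ≤ D v

Reduced : (H : Multigraph) → Div H → Fin (nV H) → Set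
Reduced H D q =
  (∀ v → v ≢ q → 0ℤ ≤ D v) ×
  (∀ A → Valid H D A → (∃ λ v → A v ≡ true) → A q ≡ true)

-- The process is monotone
-- and stabilises after at most nV H rounds, so the final burned set is
-- the set after nV H rounds.

burnAfter : (H : Multigraph) → Div H → Fin (nV H) → ℕ → Fin (nV H) → Bool
burnAfter H D q zero    v = ⌊ v ≟ q ⌋
burnAfter H D q (suc t) v =
  burnAfter H D q t v ∨ ⌊ D v <? + edgesTo H (burnAfter H D q t) v ⌋

burned : (H : Multigraph) → Div H → Fin (nV H) → Fin (nV H) → Bool
burned H D q = burnAfter H D q (nV H)

-- [v0, v_i)^{e_i}: vertices of the path of e (incident with v0) minus
-- the other endpoint, i.e. ι v0 together with the internal vertices of e.

inSegment : ∀ {G H} → Subdivision G H → Fin (nV G) → Fin (nE G) →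
            Fin (nV H) → Bool
inSegment S v0 e x = ⌊ x ≟ ι S v0 ⌋ ∨ anyF (λ j → ⌊ lookup (inner S e) j ≟ x ⌋)

inUnion : ∀ {G H} → Subdivision G H → Fin (nV G) → (Fin (nE G) → Bool) →
          Fin (nV H) → Bool
inUnion S v0 I x = anyF (λ e → I e ∧ inSegment S v0 e x)

{-# OPTIONS --safe #-}
module Submission where

-- (a) As rank D ≥ 1, D − w = D′ + L y with D′ effective. On the set A where y is
-- maximal, (L y)(v) is at least the number of edges leaving A at v, so
-- D(v) ≥ (D − w)(v) ≥ (L y)(v) makes A valid; A misses w since D(w) = 0, and A
-- contains v₀ since D is v₀-reduced. A fire started outside a valid set never
-- enters it.
-- (b) The path of an edge e ∈ I runs from the unburnt vertex v₀ to the burnt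
-- vertex vₑ, so some edge of it joins an unburnt vertex of [v₀, vₑ) to a burnt
-- one; these edges are distinct for distinct e. When the fire stops, an unburnt
-- vertex x has at most D(x) burnt edges, and D ≥ 0 away from v₀.

open import Defs
import Algebra.Properties.CommutativeMonoid.Sum as CommutativeMonoidSum
open import Data.Bool using (Bool; true; false; if_then_else_; _∧_; _∨_; not)
import Data.Bool.Properties as Bool
open import Data.Empty using (⊥-elim)
open import Data.Fin using (Fin; zero; suc; inject₁; fromℕ)
open import Data.Fin.Properties using (_≟_; suc-injective)
open import Data.Integer using (ℤ; +_; -_; 0ℤ; _≤_; _-_; _+_; _<?_; +≤+) renaming (suc to sucℤ)
import Data.Integer.Properties as ℤ
open import Data.List using (allFin)
open import Data.List.Extrema ℤ.≤-totalOrder using (argmax; f[xs]≤f[argmax])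
open import Data.List.Membership.Propositional.Properties using (∈-allFin)
import Data.List.Relation.Unary.All as All
open import Data.Nat using (ℕ; zero; suc; z≤n; s≤s)
import Data.Nat as ℕ
import Data.Nat.Properties as ℕ
open import Data.Product using (Σ; ∃; _×_; _,_; proj₁; proj₂)
open import Data.Sum using (_⊎_; inj₁; inj₂; swap; map₂)
open import Data.Vec using (Vec; []; _∷_; _∷ʳ_; lookup)
open import Function using (_∘_; case_of_)
open import Function.Bundles using (Equivalence; Inverse; Injection)
open import Function.Properties.Inverse using (↔-sym; ↔⇒↣)
open import Relation.Binary.Definitions using (DecidableEquality)
open import Relation.Binary.PropositionalEquality
open import Relation.Nullary using (Dec; ¬_; yes; no)
open import Relation.Nullary.Decidable using (⌊_⌋; dec-true; dec-false; isYes≗does; ⌊⌋-map′; toWitness)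

private
  module Σℤ = CommutativeMonoidSum ℤ.+-0-commutativeMonoid

⌊⌋-sound : ∀ {a} {A : Set a} (a? : Dec A) → ⌊ a? ⌋ ≡ true → A
⌊⌋-sound a? a?≡true = toWitness (Equivalence.from Bool.T-≡ a?≡true)

⌊⌋-complete : ∀ {a} {A : Set a} (a? : Dec A) → A → ⌊ a? ⌋ ≡ true
⌊⌋-complete a? a = trans (isYes≗does a?) (dec-true a? a)

⌊⌋-false : ∀ {a} {A : Set a} (a? : Dec A) → ¬ A → ⌊ a? ⌋ ≡ false
⌊⌋-false a? ¬a = trans (isYes≗does a?) (dec-false a? ¬a)

≟-suc : ∀ {n} (a b : Fin n) → ⌊ suc a ≟ suc b ⌋ ≡ ⌊ a ≟ b ⌋
≟-suc a b = ⌊⌋-map′ (cong suc) suc-injective (a ≟ b)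

_⊆ᵇ_ : ∀ {n} → (Fin n → Bool) → (Fin n → Bool) → Set
P ⊆ᵇ Q = ∀ i → P i ≡ true → Q i ≡ true

⊆ᵇ-antisym : ∀ {n} {P Q : Fin n → Bool} → P ⊆ᵇ Q → Q ⊆ᵇ P → P ≗ Q
⊆ᵇ-antisym {P = P} {Q} P⊆Q Q⊆P i with P i in Pi | Q i in Qi
... | true  | true  = refl
... | false | false = refl
... | true  | false = case trans (sym (P⊆Q i Pi)) Qi of λ ()
... | false | true  = case trans (sym (Q⊆P i Qi)) Pi of λ ()

countF-false : ∀ {n} (P : Fin n → Bool) → (∀ i → P i ≡ false) → countF P ≡ 0
countF-false {zero}  P P≡false = refl
countF-false {suc n} P P≡false rewrite P≡false zero = countF-false (P ∘ suc) (P≡false ∘ suc)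

countF≤n : ∀ {n} (P : Fin n → Bool) → countF P ℕ.≤ n
countF≤n {zero}  P = z≤n
countF≤n {suc n} P with P zero
... | true  = s≤s (countF≤n (P ∘ suc))
... | false = ℕ.m≤n⇒m≤1+n (countF≤n (P ∘ suc))

countF-mono-≤ : ∀ {n} {P Q : Fin n → Bool} → P ⊆ᵇ Q → countF P ℕ.≤ countF Q
countF-mono-≤ {zero}                P⊆Q = z≤n
countF-mono-≤ {suc n} {P = P} {Q} P⊆Q = ℕ.+-mono-≤ head (countF-mono-≤ (P⊆Q ∘ suc))
  where
  head : (if P zero then 1 else 0) ℕ.≤ (if Q zero then 1 else 0)
  head with P zero in P₀
  ... | false = z≤n
  ... | true rewrite P⊆Q zero P₀ = s≤s z≤n

countF-mono-< : ∀ {n} {P Q : Fin n → Bool} → P ⊆ᵇ Q →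
  ∀ i → P i ≡ false → Q i ≡ true → countF P ℕ.< countF Q
countF-mono-< P⊆Q zero Pi Qi rewrite Pi | Qi = s≤s (countF-mono-≤ (P⊆Q ∘ suc))
countF-mono-< {P = P} P⊆Q (suc i) Pi Qi with P zero in P₀
... | false = ℕ.≤-trans (countF-mono-< (P⊆Q ∘ suc) i Pi Qi) (ℕ.m≤n+m _ _)
... | true rewrite P⊆Q zero P₀ = s≤s (countF-mono-< (P⊆Q ∘ suc) i Pi Qi)

⊆ᵇ-countF-≥ : ∀ {n} {P Q : Fin n → Bool} → P ⊆ᵇ Q → countF Q ℕ.≤ countF P → Q ⊆ᵇ P
⊆ᵇ-countF-≥ {P = P} P⊆Q Q≤P i Qi with P i in Pi
... | true  = refl
... | false = ⊥-elim (ℕ.<⇒≱ (countF-mono-< P⊆Q i Pi Qi) Q≤P)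

countF-cong : ∀ {n} {P Q : Fin n → Bool} → P ≗ Q → countF P ≡ countF Q
countF-cong P≗Q = ℕ.≤-antisym (countF-mono-≤ (λ i Pi → trans (sym (P≗Q i)) Pi))
                              (countF-mono-≤ (λ i Qi → trans (P≗Q i) Qi))

countF-unique : ∀ {n} {P : Fin n → Bool} →
  (∀ {i j} → P i ≡ true → P j ≡ true → i ≡ j) → countF P ℕ.≤ 1
countF-unique {zero}          unique = z≤n
countF-unique {suc n} {P = P} unique with P zero in P₀
... | false = countF-unique (λ Pi Pj → suc-injective (unique Pi Pj))
... | true  = ℕ.≤-reflexive (cong suc (countF-false (P ∘ suc) rest))
  where
  rest : ∀ i → P (suc i) ≡ false
  rest i = Bool.¬-not (λ Pi → case unique P₀ Pi of λ ())

countF-≤-unique : ∀ {n} {P : Fin n → Bool} (b : Bool) →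
  (∀ {i j} → P i ≡ true → P j ≡ true → i ≡ j) → (∀ {i} → P i ≡ true → b ≡ true) →
  countF P ℕ.≤ (if b then 1 else 0)
countF-≤-unique true  unique _   = countF-unique unique
countF-≤-unique {P = P} false _ P⇒b =
  ℕ.≤-reflexive (countF-false P (λ i → Bool.¬-not (λ Pi → case P⇒b Pi of λ ())))

anyF-intro : ∀ {n} (P : Fin n → Bool) i → P i ≡ true → anyF P ≡ true
anyF-intro P zero    Pi rewrite Pi = refl
anyF-intro P (suc i) Pi rewrite anyF-intro (P ∘ suc) i Pi = Bool.∨-zeroʳ (P zero)

anyF≤countF : ∀ {n} (P : Fin n → Bool) → (if anyF P then 1 else 0) ℕ.≤ countF P
anyF≤countF {zero}  P = z≤n
anyF≤countF {suc n} P with P zero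
... | true  = s≤s z≤n
... | false = anyF≤countF (P ∘ suc)

countF-≟ : ∀ {n} (a : Fin n) → countF (λ j → ⌊ a ≟ j ⌋) ≡ 1
countF-≟ {suc n} zero = cong suc (countF-false {n} _ λ _ → refl)
countF-≟ (suc a) = trans (countF-cong (≟-suc a)) (countF-≟ a)

countF-fibre : ∀ {n} (a : Fin n) (b : Bool) → countF (λ j → b ∧ ⌊ a ≟ j ⌋) ≡ (if b then 1 else 0)
countF-fibre a true  = countF-≟ a
countF-fibre {n} a false = countF-false {n} _ λ _ → refl

-- Sums over Fin n and double counting

𝟙 : Bool → ℤ
𝟙 b = + (if b then 1 else 0)

sumℤ≡sum : ∀ {n} (f : Fin n → ℤ) → sumℤ f ≡ Σℤ.sum f
sumℤ≡sum {zero}  f = refl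
sumℤ≡sum {suc n} f = cong (_+_ (f zero)) (sumℤ≡sum (f ∘ suc))

sumℤ-cong : ∀ {n} {f g : Fin n → ℤ} → f ≗ g → sumℤ f ≡ sumℤ g
sumℤ-cong {f = f} {g} f≗g =
  trans (sumℤ≡sum f) (trans (Σℤ.sum-cong-≗ f≗g) (sym (sumℤ≡sum g)))

sumℤ-mono-≤ : ∀ {n} {f g : Fin n → ℤ} → (∀ i → f i ≤ g i) → sumℤ f ≤ sumℤ g
sumℤ-mono-≤ {zero}  f≤g = ℤ.≤-refl
sumℤ-mono-≤ {suc n} f≤g = ℤ.+-mono-≤ (f≤g zero) (sumℤ-mono-≤ (f≤g ∘ suc))

sumℤ-comm : ∀ {m n} (f : Fin m → Fin n → ℤ) →
  sumℤ (λ i → sumℤ (f i)) ≡ sumℤ (λ j → sumℤ (λ i → f i j))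
sumℤ-comm f = begin
  sumℤ (λ i → sumℤ (f i))                ≡⟨ sumℤ-cong (λ i → sumℤ≡sum (f i)) ⟩
  sumℤ (λ i → Σℤ.sum (f i))              ≡⟨ sumℤ≡sum (λ i → Σℤ.sum (f i)) ⟩
  Σℤ.sum (λ i → Σℤ.sum (f i))            ≡⟨ Σℤ.∑-comm f ⟩
  Σℤ.sum (λ j → Σℤ.sum (λ i → f i j))    ≡⟨ sumℤ≡sum (λ j → Σℤ.sum (λ i → f i j)) ⟨
  sumℤ (λ j → Σℤ.sum (λ i → f i j))      ≡⟨ sumℤ-cong (λ j → sumℤ≡sum (λ i → f i j)) ⟨
  sumℤ (λ j → sumℤ (λ i → f i j))        ∎
  where open ≡-Reasoning

countF≡sumℤ : ∀ {n} (P : Fin n → Bool) → + countF P ≡ sumℤ (𝟙 ∘ P)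
countF≡sumℤ {zero}  P = refl
countF≡sumℤ {suc n} P =
  trans (ℤ.pos-+ (if P zero then 1 else 0) (countF (P ∘ suc)))
        (cong (_+_ (𝟙 (P zero))) (countF≡sumℤ (P ∘ suc)))

countF-≤-injection : ∀ {m n} {P : Fin m → Bool} {Q : Fin n → Bool} (φ : Fin m → Fin n) →
  (∀ {i j} → P i ≡ true → P j ≡ true → φ i ≡ φ j → i ≡ j) →
  (∀ {i} → P i ≡ true → Q (φ i) ≡ true) → countF P ℕ.≤ countF Q
countF-≤-injection {m} {n} {P} {Q} φ φ-injective φ-into = ℤ.drop‿+≤+ (begin
  + countF P                                  ≡⟨ countF≡sumℤ P ⟩
  sumℤ (𝟙 ∘ P)                                ≡⟨ sumℤ-cong row ⟩
  sumℤ (λ i → sumℤ (λ j → 𝟙 (Graph i j)))     ≡⟨ sumℤ-comm (λ i j → 𝟙 (Graph i j)) ⟩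
  sumℤ (λ j → sumℤ (λ i → 𝟙 (Graph i j)))     ≡⟨ sumℤ-cong (λ j → countF≡sumℤ (λ i → Graph i j)) ⟨
  sumℤ (λ j → + countF (λ i → Graph i j))     ≤⟨ sumℤ-mono-≤ (λ j → +≤+ (column j)) ⟩
  sumℤ (𝟙 ∘ Q)                                ≡⟨ countF≡sumℤ Q ⟨
  + countF Q                                  ∎)
  where
  open ℤ.≤-Reasoning
  Graph : Fin m → Fin n → Bool
  Graph i j = P i ∧ ⌊ φ i ≟ j ⌋
  row : ∀ i → 𝟙 (P i) ≡ sumℤ (λ j → 𝟙 (Graph i j))
  row i = trans (cong +_ (sym (countF-fibre (φ i) (P i)))) (countF≡sumℤ (Graph i))
  graph : ∀ {i j} → Graph i j ≡ true → P i ≡ true × φ i ≡ j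
  graph G = Bool.∧-conicalˡ _ _ G , ⌊⌋-sound (_ ≟ _) (Bool.∧-conicalʳ _ _ G)
  column : ∀ j → countF (λ i → Graph i j) ℕ.≤ (if Q j then 1 else 0)
  column j = countF-≤-unique (Q j)
    (λ Gi Gj → φ-injective (proj₁ (graph Gi)) (proj₁ (graph Gj))
                           (trans (proj₂ (graph Gi)) (sym (proj₂ (graph Gj)))))
    (λ Gi → subst (λ k → Q k ≡ true) (proj₂ (graph Gi)) (φ-into (proj₁ (graph Gi))))

countF-anyF≤sumℤ : ∀ {m n} (R : Fin m → Fin n → Bool) →
  + countF (λ j → anyF (λ i → R i j)) ≤ sumℤ (λ i → + countF (R i))
countF-anyF≤sumℤ R = begin
  + countF (λ j → anyF (λ i → R i j))         ≡⟨ countF≡sumℤ (λ j → anyF (λ i → R i j)) ⟩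
  sumℤ (λ j → 𝟙 (anyF (λ i → R i j)))         ≤⟨ sumℤ-mono-≤ column ⟩
  sumℤ (λ j → sumℤ (λ i → 𝟙 (R i j)))         ≡⟨ sumℤ-comm (λ j i → 𝟙 (R i j)) ⟩
  sumℤ (λ i → sumℤ (λ j → 𝟙 (R i j)))         ≡⟨ sumℤ-cong (λ i → countF≡sumℤ (R i)) ⟨
  sumℤ (λ i → + countF (R i))                 ∎
  where
  open ℤ.≤-Reasoning
  column : ∀ j → 𝟙 (anyF (λ i → R i j)) ≤ sumℤ (λ i → 𝟙 (R i j))
  column j = ℤ.≤-trans (+≤+ (anyF≤countF (λ i → R i j))) (ℤ.≤-reflexive (countF≡sumℤ (λ i → R i j)))

∨∧-mono : ∀ a c {b b′ d d′} → (b ≡ true → b′ ≡ true) → (d ≡ true → d′ ≡ true) →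
  (a ∧ b) ∨ (c ∧ d) ≡ true → (a ∧ b′) ∨ (c ∧ d′) ≡ true
∨∧-mono true  _     {true}  b⇒b′ _    _  rewrite b⇒b′ refl = refl
∨∧-mono true  true  {false} {d = true} _ d⇒d′ _ rewrite d⇒d′ refl = Bool.∨-zeroʳ _
∨∧-mono false true  {d = true} _ d⇒d′ _ rewrite d⇒d′ refl = refl
∨∧-mono true  false {false} _ _ ()
∨∧-mono true  true  {false} {d = false} _ _ ()
∨∧-mono false false _ _ ()
∨∧-mono false true  {d = false} _ _ ()

module _ (H : Multigraph) where

  edgeTo : (Fin (nV H) → Bool) → Fin (nV H) → Fin (nE H) → Bool
  edgeTo P v f = (⌊ src H f ≟ v ⌋ ∧ P (tgt H f)) ∨ (⌊ tgt H f ≟ v ⌋ ∧ P (src H f))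

  Joins : Fin (nE H) → Fin (nV H) → Fin (nV H) → Set
  Joins f a b = (src H f ≡ a × tgt H f ≡ b) ⊎ (src H f ≡ b × tgt H f ≡ a)

  edgeTo-mono : ∀ {P Q} v → P ⊆ᵇ Q → edgeTo P v ⊆ᵇ edgeTo Q v
  edgeTo-mono v P⊆Q f =
    ∨∧-mono ⌊ src H f ≟ v ⌋ ⌊ tgt H f ≟ v ⌋ (P⊆Q (tgt H f)) (P⊆Q (src H f))

  edgesTo-mono : ∀ {P Q} v → P ⊆ᵇ Q → edgesTo H P v ℕ.≤ edgesTo H Q v
  edgesTo-mono v P⊆Q = countF-mono-≤ (edgeTo-mono v P⊆Q)

  edgeTo-joins : ∀ {P f x y} → Joins f x y → P y ≡ true → edgeTo P x f ≡ true
  edgeTo-joins {x = x} (inj₁ (refl , refl)) Py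
    rewrite ⌊⌋-complete (x ≟ x) refl | Py = refl
  edgeTo-joins {x = x} (inj₂ (refl , refl)) Py
    rewrite ⌊⌋-complete (x ≟ x) refl | Py = Bool.∨-zeroʳ _

  edgeTo-crossing : ∀ {P f a b} → Joins f a b → P a ≢ P b →
    (P a ≡ false × edgeTo P a f ≡ true) ⊎ (P b ≡ false × edgeTo P b f ≡ true)
  edgeTo-crossing {P} {a = a} {b} ab Pa≢Pb with P a in Pa | P b in Pb
  ... | false | true  = inj₁ (refl , edgeTo-joins ab Pb)
  ... | true  | false = inj₂ (refl , edgeTo-joins (swap ab) Pa)
  ... | true  | true  = ⊥-elim (Pa≢Pb refl)
  ... | false | false = ⊥-elim (Pa≢Pb refl)

-- Dhar's burning algorithm

module Stabilisation {n} (F : (Fin n → Bool) → (Fin n → Bool))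
  (F-mono : ∀ {P Q} → P ⊆ᵇ Q → F P ⊆ᵇ F Q) (F-inflationary : ∀ P → P ⊆ᵇ F P)
  (S : ℕ → Fin n → Bool) (S-step : ∀ t → S (suc t) ≗ F (S t)) where

  S-increasing : ∀ t → S t ⊆ᵇ S (suc t)
  S-increasing t v Sv = trans (S-step t v) (F-inflationary (S t) v Sv)

  S-fixed : ∀ t → S (suc t) ≗ S t → S (suc (suc t)) ≗ S (suc t)
  S-fixed t fixed = ⊆ᵇ-antisym shrinks (S-increasing (suc t))
    where
    shrinks : S (suc (suc t)) ⊆ᵇ S (suc t)
    shrinks v S₂v = trans (S-step t v)
      (F-mono (λ u S₁u → trans (sym (fixed u)) S₁u) v (trans (sym (S-step (suc t) v)) S₂v))

  S-fixed-or-grows : ∀ t → S (suc t) ≗ S t ⊎ countF (S t) ℕ.< countF (S (suc t))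
  S-fixed-or-grows t with countF (S (suc t)) ℕ.≤? countF (S t)
  ... | yes ≤ = inj₁ (⊆ᵇ-antisym (⊆ᵇ-countF-≥ (S-increasing t) ≤) (S-increasing t))
  ... | no ≰  = inj₂ (ℕ.≰⇒> ≰)

  S-fixed-or-large : ∀ t → S (suc t) ≗ S t ⊎ t ℕ.< countF (S (suc t))
  S-fixed-or-large zero = map₂ (ℕ.≤-<-trans z≤n) (S-fixed-or-grows zero)
  S-fixed-or-large (suc t) with S-fixed-or-large t | S-fixed-or-grows (suc t)
  ... | inj₁ fixed | _          = inj₁ (S-fixed t fixed)
  ... | inj₂ _     | inj₁ fixed = inj₁ fixed
  ... | inj₂ large | inj₂ grows = inj₂ (ℕ.<-≤-trans (s≤s large) grows)

  S-stable : S (suc n) ≗ S n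
  S-stable with S-fixed-or-large n
  ... | inj₁ fixed = fixed
  ... | inj₂ large = ⊥-elim (ℕ.<⇒≱ large (countF≤n (S (suc n))))

module _ (H : Multigraph) (D : Div H) where

  burnStep : (Fin (nV H) → Bool) → (Fin (nV H) → Bool)
  burnStep P v = P v ∨ ⌊ D v <? + edgesTo H P v ⌋

  burnStep-inflationary : ∀ P → P ⊆ᵇ burnStep P
  burnStep-inflationary P v Pv rewrite Pv = refl

  burnStep-mono : ∀ {P Q} → P ⊆ᵇ Q → burnStep P ⊆ᵇ burnStep Q
  burnStep-mono {P} {Q} P⊆Q v with P v in Pv
  ... | true  = λ _ → cong (_∨ ⌊ D v <? + edgesTo H Q v ⌋) (P⊆Q v Pv)
  ... | false = λ fires → trans (cong (Q v ∨_) (⌊⌋-complete (D v <? _)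
      (ℤ.<-≤-trans (⌊⌋-sound (D v <? _) fires) (+≤+ (edgesTo-mono H v P⊆Q))))) (Bool.∨-zeroʳ _)

  burned-stable : ∀ q → burnAfter H D q (suc (nV H)) ≗ burned H D q
  burned-stable q = Stabilisation.S-stable burnStep burnStep-mono burnStep-inflationary
                                           (burnAfter H D q) (λ _ _ → refl)

  unburnt-edgesTo-≤ : ∀ q v → burned H D q v ≡ false → + edgesTo H (burned H D q) v ≤ D v
  unburnt-edgesTo-≤ q v unburnt =
    ℤ.≮⇒≥ (λ fires → case trans (sym (⌊⌋-complete (D v <? _) fires)) quiet of λ ())
    where
    test : Bool
    test = ⌊ D v <? + edgesTo H (burned H D q) v ⌋
    quiet : test ≡ false
    quiet = trans (sym (cong (_∨ test) unburnt)) (trans (burned-stable q v) unburnt)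

  valid-unburnt : ∀ {A q} → Valid H D A → A q ≡ false →
    ∀ t v → A v ≡ true → burnAfter H D q t v ≡ false
  valid-unburnt {A} {q} valid Aq zero v Av =
    ⌊⌋-false (v ≟ q) (λ { refl → case trans (sym Av) Aq of λ () })
  valid-unburnt {A} {q} valid Aq (suc t) v Av rewrite valid-unburnt valid Aq t v Av =
    ⌊⌋-false (D v <? _) (λ fires →
      ℤ.<⇒≱ fires (ℤ.≤-trans (+≤+ (edgesTo-mono H v burnt⊆outside)) (valid v Av)))
    where
    burnt⊆outside : burnAfter H D q t ⊆ᵇ (not ∘ A)
    burnt⊆outside u burnt with A u in Au
    ... | false = refl
    ... | true  = case trans (sym burnt) (valid-unburnt valid Aq t u Au) of λ ()

-- Valid sets of a divisor of rank at least 1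

𝟙-not-≟-≤-gap : ∀ {z M} → z ≤ M → 𝟙 (not ⌊ z ℤ.≟ M ⌋) ≤ M - z
𝟙-not-≟-≤-gap {z} {M} z≤M with z ℤ.≟ M
... | yes _   = ℤ.i≤j⇒0≤j-i z≤M
... | no  z≢M = subst (λ k → sucℤ k ≤ M - z) (ℤ.+-inverseʳ z)
                  (ℤ.i<j⇒suc[i]≤j (ℤ.+-monoˡ-< (- z) (ℤ.≤∧≢⇒< z≤M z≢M)))

0≤j⇒i-j≤i : ∀ i {j} → 0ℤ ≤ j → i - j ≤ i
0≤j⇒i-j≤i i (+≤+ {n = n} _) = ℤ.i-j≤i i (+ n)

module _ {n} (y : Fin n → ℤ) {M : ℤ} (y≤M : ∀ u → y u ≤ M) where

  𝟙-belowMax-≤-edgeTerm : ∀ s t v → y v ≡ M →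
    𝟙 ((⌊ s ≟ v ⌋ ∧ not ⌊ y t ℤ.≟ M ⌋) ∨ (⌊ t ≟ v ⌋ ∧ not ⌊ y s ℤ.≟ M ⌋)) ≤
    (if ⌊ s ≟ v ⌋ then y s - y t else 0ℤ) + (if ⌊ t ≟ v ⌋ then y t - y s else 0ℤ)
  𝟙-belowMax-≤-edgeTerm s t v yv≡M with s ≟ v | t ≟ v
  ... | yes refl | yes refl rewrite ⌊⌋-complete (y s ℤ.≟ M) yv≡M | ℤ.+-inverseʳ (y s) = ℤ.≤-refl
  ... | yes refl | no _
    rewrite Bool.∨-identityʳ (not ⌊ y t ℤ.≟ M ⌋) | ℤ.+-identityʳ (y s - y t) | yv≡M = 𝟙-not-≟-≤-gap (y≤M t)
  ... | no _ | yes refl rewrite ℤ.+-identityˡ (y t - y s) | yv≡M = 𝟙-not-≟-≤-gap (y≤M s)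
  ... | no _ | no _ = ℤ.≤-refl

module _ (H : Multigraph) where

  belowMax-edgesTo-≤-laplacian : ∀ (y : Fin (nV H) → ℤ) {M} → (∀ u → y u ≤ M) →
    ∀ v → y v ≡ M → + edgesTo H (λ u → not ⌊ y u ℤ.≟ M ⌋) v ≤ laplacian H y v
  belowMax-edgesTo-≤-laplacian y y≤M v yv≡M = ℤ.≤-trans
    (ℤ.≤-reflexive (countF≡sumℤ (edgeTo H (λ u → not ⌊ y u ℤ.≟ _ ⌋) v)))
    (sumℤ-mono-≤ (λ f → 𝟙-belowMax-≤-edgeTerm y y≤M (src H f) (tgt H f) v yv≡M))

  δ : Fin (nV H) → Div H
  δ w v = 𝟙 ⌊ w ≟ v ⌋

  deg-δ : ∀ w → deg H (δ w) ≡ + 1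
  deg-δ w = trans (sym (countF≡sumℤ (λ v → ⌊ w ≟ v ⌋))) (cong +_ (countF-≟ w))

  rank≥1⇒valid-avoiding : ∀ {D} → RankAtLeast H D 1 → ∀ w → D w ≡ 0ℤ →
    ∃ λ A → Valid H D A × A w ≡ false × ∃ λ v → A v ≡ true
  rank≥1⇒valid-avoiding {D} rank w Dw≡0
    with rank (δ w) (λ _ → +≤+ z≤n) (deg-δ w)
  ... | D′ , D′≥0 , y , D-δ-D′≡Ly = A , valid , Aw≡false , (top , ⌊⌋-complete (M ℤ.≟ M) refl)
    where
    top : Fin (nV H)
    top = argmax y w (allFin (nV H))
    M : ℤ
    M = y top
    y≤M : ∀ u → y u ≤ M
    y≤M u = All.lookup (f[xs]≤f[argmax] w (allFin (nV H))) (∈-allFin u)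
    A : Fin (nV H) → Bool
    A u = ⌊ y u ℤ.≟ M ⌋
    Ly≤D-δ : ∀ v → laplacian H y v ≤ D v - δ w v
    Ly≤D-δ v = subst (_≤ D v - δ w v) (D-δ-D′≡Ly v) (0≤j⇒i-j≤i (D v - δ w v) (D′≥0 v))
    exits≤D-δ : ∀ v → A v ≡ true → + edgesTo H (not ∘ A) v ≤ D v - δ w v
    exits≤D-δ v Av =
      ℤ.≤-trans (belowMax-edgesTo-≤-laplacian y y≤M v (⌊⌋-sound (y v ℤ.≟ M) Av)) (Ly≤D-δ v)
    valid : Valid H D A
    valid v Av = ℤ.≤-trans (exits≤D-δ v Av) (0≤j⇒i-j≤i (D v) (+≤+ z≤n))
    D-δ-at-w : D w - δ w w ≡ 0ℤ - + 1
    D-δ-at-w = cong₂ _-_ Dw≡0 (cong 𝟙 (⌊⌋-complete (w ≟ w) refl))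
    Aw≡false : A w ≡ false
    Aw≡false = Bool.¬-not λ Aw →
      case subst (0ℤ ≤_) D-δ-at-w (ℤ.≤-trans (+≤+ z≤n) (exits≤D-δ w Aw)) of λ ()

reduced⇒source-unburnt : ∀ H D q → RankAtLeast H D 1 → Reduced H D q →
  ∀ w → D w ≡ 0ℤ → burned H D w q ≡ false
reduced⇒source-unburnt H D q rank reduced w Dw≡0 with rank≥1⇒valid-avoiding H rank w Dw≡0
... | A , valid , Aw≡false , nonempty =
  valid-unburnt H D valid Aw≡false (nV H) q (proj₂ reduced A valid nonempty)

-- Paths of a subdivision

firstChange : ∀ {a} {A : Set a} → DecidableEquality A → ∀ k → (Fin (suc (suc k)) → A) → Fin (suc k)
firstChange _≟ᴬ_ zero    g = zero
firstChange _≟ᴬ_ (suc k) g with g zero ≟ᴬ g (suc zero)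
... | yes _ = suc (firstChange _≟ᴬ_ k (g ∘ suc))
... | no  _ = zero

firstChange-≢ : ∀ {a} {A : Set a} (_≟ᴬ_ : DecidableEquality A) k (g : Fin (suc (suc k)) → A) →
  g zero ≢ g (fromℕ (suc k)) →
  g (inject₁ (firstChange _≟ᴬ_ k g)) ≢ g (suc (firstChange _≟ᴬ_ k g))
firstChange-≢ _≟ᴬ_ zero    g ends≢ = ends≢
firstChange-≢ _≟ᴬ_ (suc k) g ends≢ with g zero ≟ᴬ g (suc zero)
... | yes g₀≡g₁ = firstChange-≢ _≟ᴬ_ k (g ∘ suc) (λ g₁≡end → ends≢ (trans g₀≡g₁ g₁≡end))
... | no  g₀≢g₁ = g₀≢g₁

lookup-∷ʳ-last : ∀ {a} {A : Set a} {n} (xs : Vec A n) y → lookup (xs ∷ʳ y) (fromℕ n) ≡ y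
lookup-∷ʳ-last []       y = refl
lookup-∷ʳ-last (x ∷ xs) y = lookup-∷ʳ-last xs y

lookup-∷ʳ : ∀ {a} {A : Set a} {n} (xs : Vec A n) y k →
  lookup (xs ∷ʳ y) k ≡ y ⊎ ∃ λ j → lookup (xs ∷ʳ y) k ≡ lookup xs j
lookup-∷ʳ []       y zero    = inj₁ refl
lookup-∷ʳ (x ∷ xs) y zero    = inj₂ (zero , refl)
lookup-∷ʳ (x ∷ xs) y (suc k) = map₂ (λ (j , eq) → suc j , eq) (lookup-∷ʳ xs y k)

module _ {G H : Multigraph} (S : Subdivision G H) where

  pathEdge : (e : Fin (nE G)) → Fin (suc (len S e)) → Fin (nE H)
  pathEdge e j = Inverse.from (edgeMap S) (e , j)

  pathEdge-injective : ∀ {e e′ j j′} → pathEdge e j ≡ pathEdge e′ j′ → e ≡ e′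
  pathEdge-injective eq = cong proj₁ (Injection.injective (↔⇒↣ (↔-sym (edgeMap S))) eq)

  pathEdge-joins : ∀ e j →
    Joins H (pathEdge e j) (lookup (walk S e) (inject₁ j)) (lookup (walk S e) (suc j))
  pathEdge-joins e j =
    subst JoinsStep (Inverse.strictlyInverseˡ (edgeMap S) (e , j)) (edgeEnds S (pathEdge e j))
    where
    JoinsStep : Σ (Fin (nE G)) (λ e → Fin (suc (len S e))) → Set
    JoinsStep (e′ , j′) =
      Joins H (pathEdge e j) (lookup (walk S e′) (inject₁ j′)) (lookup (walk S e′) (suc j′))

  walk-last : ∀ e → lookup (walk S e) (fromℕ (suc (len S e))) ≡ ι S (tgt G e)
  walk-last e = lookup-∷ʳ-last (inner S e) (ι S (tgt G e))

  walk-vertex : ∀ e k →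
    lookup (walk S e) k ≡ ι S (src G e) ⊎ lookup (walk S e) k ≡ ι S (tgt G e) ⊎
    ∃ λ j → lookup (walk S e) k ≡ lookup (inner S e) j
  walk-vertex e zero    = inj₁ refl
  walk-vertex e (suc k) = inj₂ (lookup-∷ʳ (inner S e) (ι S (tgt G e)) k)

  ι∈segment : ∀ v0 e {x} → x ≡ ι S v0 → inSegment S v0 e x ≡ true
  ι∈segment v0 e refl rewrite ⌊⌋-complete (ι S v0 ≟ ι S v0) refl = refl

  inner∈segment : ∀ v0 e j {x} → x ≡ lookup (inner S e) j → inSegment S v0 e x ≡ true
  inner∈segment v0 e j refl
    rewrite anyF-intro (λ i → ⌊ lookup (inner S e) i ≟ lookup (inner S e) j ⌋) j (⌊⌋-complete (_ ≟ _) refl)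
    = Bool.∨-zeroʳ _

module SegmentBound {G H : Multigraph} (S : Subdivision G H) (v0 : Fin (nV G)) (D : Div H)
  (B : Fin (nV H) → Bool) (v0-unburnt : B (ι S v0) ≡ false)
  (unburnt-edgesTo-≤ : ∀ x → B x ≡ false → + edgesTo H B x ≤ D x)
  (D-nonneg : ∀ x → x ≢ ι S v0 → 0ℤ ≤ D x) (I : Fin (nE G) → Bool) where

  LeadsToBurnt : Fin (nE G) → Set
  LeadsToBurnt e =
    (src G e ≡ v0 × B (ι S (tgt G e)) ≡ true) ⊎ (tgt G e ≡ v0 × B (ι S (src G e)) ≡ true)

  walkBurnt : (e : Fin (nE G)) → Fin (suc (suc (len S e))) → Bool
  walkBurnt e k = B (lookup (walk S e) k)

  burnt-≢-unburnt : ∀ {x y} → B x ≡ true → B y ≡ false → x ≢ y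
  burnt-≢-unburnt Bx By x≡y = case trans (sym Bx) (trans (cong B x≡y) By) of λ ()

  ι-unburnt : ∀ {u} → u ≡ v0 → B (ι S u) ≡ false
  ι-unburnt u≡v0 = trans (cong (B ∘ ι S) u≡v0) v0-unburnt

  walk-ends-differ : ∀ {e} → LeadsToBurnt e → walkBurnt e zero ≢ walkBurnt e (fromℕ (suc (len S e)))
  walk-ends-differ {e} (inj₁ (s≡v0 , Bt)) ends≡ =
    case trans (sym (ι-unburnt s≡v0)) (trans ends≡ (trans (cong B (walk-last S e)) Bt)) of λ ()
  walk-ends-differ {e} (inj₂ (t≡v0 , Bs)) ends≡ =
    case trans (sym Bs) (trans ends≡ (trans (cong B (walk-last S e)) (ι-unburnt t≡v0))) of λ ()

  unburnt-walk∈segment : ∀ {e} → LeadsToBurnt e → ∀ k → walkBurnt e k ≡ false →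
    inSegment S v0 e (lookup (walk S e) k) ≡ true
  unburnt-walk∈segment {e} leads k unburnt with walk-vertex S e k | leads
  ... | inj₁ at-s        | inj₁ (s≡v0 , _) = ι∈segment S v0 e (trans at-s (cong (ι S) s≡v0))
  ... | inj₁ at-s        | inj₂ (_ , Bs)   = ⊥-elim (burnt-≢-unburnt Bs unburnt (sym at-s))
  ... | inj₂ (inj₁ at-t) | inj₂ (t≡v0 , _) = ι∈segment S v0 e (trans at-t (cong (ι S) t≡v0))
  ... | inj₂ (inj₁ at-t) | inj₁ (_ , Bt)   = ⊥-elim (burnt-≢-unburnt Bt unburnt (sym at-t))
  ... | inj₂ (inj₂ (j , at-j)) | _         = inner∈segment S v0 e j at-j

  crossingIndex : (e : Fin (nE G)) → Fin (suc (len S e))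
  crossingIndex e = firstChange Bool._≟_ (len S e) (walkBurnt e)

  crossing : Fin (nE G) → Fin (nE H)
  crossing e = pathEdge S e (crossingIndex e)

  ExitAt : Fin (nV H) → Fin (nE H) → Bool
  ExitAt x f = (inUnion S v0 I x ∧ not (B x)) ∧ edgeTo H B x f

  exitAt-walk : ∀ {e} → I e ≡ true → LeadsToBurnt e → ∀ k → walkBurnt e k ≡ false →
    edgeTo H B (lookup (walk S e) k) (crossing e) ≡ true → anyF (λ x → ExitAt x (crossing e)) ≡ true
  exitAt-walk {e} Ie leads k unburnt edge =
    anyF-intro (λ x → ExitAt x (crossing e)) (lookup (walk S e) k) exits
    where
    inUnion-x : inUnion S v0 I (lookup (walk S e) k) ≡ true
    inUnion-x = anyF-intro _ e (trans (cong (_∧ _) Ie) (unburnt-walk∈segment leads k unburnt))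
    exits : ExitAt (lookup (walk S e) k) (crossing e) ≡ true
    exits rewrite inUnion-x | unburnt | edge = refl

  crossing-exits : ∀ {e} → I e ≡ true → LeadsToBurnt e → anyF (λ x → ExitAt x (crossing e)) ≡ true
  crossing-exits {e} Ie leads
    with edgeTo-crossing H {P = B} (pathEdge-joins S e (crossingIndex e))
           (firstChange-≢ Bool._≟_ (len S e) (walkBurnt e) (walk-ends-differ leads))
  ... | inj₁ (unburnt , edge) = exitAt-walk Ie leads (inject₁ (crossingIndex e)) unburnt edge
  ... | inj₂ (unburnt , edge) = exitAt-walk Ie leads (suc (crossingIndex e)) unburnt edge

  countF-ExitAt≤ : ∀ x → + countF (ExitAt x) ≤ (if inUnion S v0 I x then D x else 0ℤ)
  countF-ExitAt≤ x with inUnion S v0 I x | B x in Bx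
  ... | true  | false = unburnt-edgesTo-≤ x Bx
  ... | true  | true  = subst (_≤ D x) (cong +_ (sym (countF-false {nE H} _ λ _ → refl)))
                          (D-nonneg x (λ x≡v0 → burnt-≢-unburnt Bx v0-unburnt x≡v0))
  ... | false | _     = ℤ.≤-reflexive (cong +_ (countF-false {nE H} _ λ _ → refl))

  segment-bound : (∀ e → I e ≡ true → LeadsToBurnt e) →
    + countF I ≤ sumℤ (λ x → if inUnion S v0 I x then D x else 0ℤ)
  segment-bound leads = begin
    + countF I                                     ≤⟨ +≤+ (countF-≤-injection crossing
                                                           (λ _ _ → pathEdge-injective S)
                                                           (λ {e} Ie → crossing-exits Ie (leads e Ie))) ⟩
    + countF (λ f → anyF (λ x → ExitAt x f))       ≤⟨ countF-anyF≤sumℤ ExitAt ⟩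
    sumℤ (λ x → + countF (ExitAt x))               ≤⟨ sumℤ-mono-≤ countF-ExitAt≤ ⟩
    sumℤ (λ x → if inUnion S v0 I x then D x else 0ℤ) ∎
    where open ℤ.≤-Reasoning

lemma4p4 : (G H : Multigraph) → Loopless G → Connected G →
    (v0 : Fin (nV G)) → (S : Subdivision G H) →
    (D : Div H) → RankAtLeast H D 1 → Reduced H D (ι S v0) →
    (w : Fin (nV H)) → D w ≡ 0ℤ →
    (burned H D w (ι S v0) ≡ false) ×
    ((I : Fin (nE G) → Bool) →
      (∀ e → I e ≡ true →
        (src G e ≡ v0 × burned H D w (ι S (tgt G e)) ≡ true) ⊎
        (tgt G e ≡ v0 × burned H D w (ι S (src G e)) ≡ true)) →
      + countF I ≤ sumℤ (λ x → if inUnion S v0 I x then D x else 0ℤ))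
lemma4p4 G H _ _ v0 S D rank reduced w Dw≡0 =
  v0-unburnt ,
  λ I leads → SegmentBound.segment-bound S v0 D (burned H D w) v0-unburnt
                (unburnt-edgesTo-≤ H D w) (proj₁ reduced) I leads
  where
  v0-unburnt : burned H D w (ι S v0) ≡ false
  v0-unburnt = reduced⇒source-unburnt H D (ι S v0) rank reduced w Dw≡0
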